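{- Let $\mathcal S=(\omega+3,\to,\|\cdot\|)$ be the model on the ordinals $<\omega+3$ with $\alpha\to\beta$ iff ($\alpha>\beta$) or ($\alpha=\beta$ and $\alpha$ is odd) or ($\alpha=\omega+1$ and $\beta=\omega+2$), with $\|p\|=\{\alpha<\omega+3:\alpha\text{ odd}\}$ and $\|q\|=\varnothing$ for every other variable $q$. Then the formula $\langle *\rangle^\infty\{p,\neg p\}$ is not definable in $\mathcal L_{\Diamond^\infty}$ over $\mathcal S$, even by an infinite set of formulas: there is no set $\Phi\subseteq\mathcal L_{\Diamond^\infty}$ (in particular no single formula) such that $\|\langle *\rangle^\infty\{p,\neg p\}\|=\bigcap_{\psi\in\Phi}\|\psi\|$ in $\mathcal S$.
   Context: Parity of ordinals below $\omega+3$: natural numbers have their usual parity, $\omega$ and $\omega+2$ are even, $\omega+1$ is odd. Formulas of $\mathcal L_\mu$: $\top\mid x\mid\neg\varphi\mid\varphi\wedge\psi\mid\Diamond\varphi\mid\nu x.\varphi$ ($\varphi$ positive in $x$), interpreted on a relational model by $\|\Diamond\varphi\|=\{w:\exists s(w\to s\in\|\varphi\|)\}$, $\|\nu x.\varphi\|=\bigcup\{X: X\subseteq\|\varphi\|_{x:=X}\}$ (greatest fixed point), Booleans as usual. Abbreviations: $\langle *\rangle\varphi=\varphi\vee\Diamond\varphi$; for finite $\Gamma$, $\Diamond^\infty\Gamma=\nu x.\bigwedge_{\gamma\in\Gamma}\Diamond(x\wedge\gamma)$ and $\langle *\rangle^\infty\Gamma=\nu x.\bigwedge_{\gamma\in\Gamma}\langle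 *\rangle(x\wedge\gamma)$. $\mathcal L_{\Diamond^\infty}$ is the language generated from $\top$ and propositional variables by $\neg$, $\wedge$, $\Diamond$ and $\Diamond^\infty\Gamma$ for finite sets $\Gamma$ of its formulas. -}

module Defs where

open import Data.Nat using (ℕ; zero; suc; _<_)
open import Data.Bool using (Bool; true; false; not)
open import Data.List using (List; []; _∷_)
open import Data.Product using (Σ; _×_; _,_)
open import Data.Sum using (_⊎_)
open import Data.Empty using (⊥)
open import Data.Unit using (⊤)
open import Relation.Binary.PropositionalEquality using (_≡_)
open import Relation.Nullary using (¬_)
open import Level using (Lift)
import Level

data Ord3 : Set where
  fin : ℕ → Ord3
  ω   : Ord3
  ω+1 : Ord3
  ω+2 : Ord3

data _<ₒ_ : Ord3 → Ord3 → Set where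
  fin<fin : ∀ {m n} → m < n → fin m <ₒ fin n
  fin<ω   : ∀ {n} → fin n <ₒ ω
  fin<ω+1 : ∀ {n} → fin n <ₒ ω+1
  fin<ω+2 : ∀ {n} → fin n <ₒ ω+2
  ω<ω+1   : ω <ₒ ω+1
  ω<ω+2   : ω <ₒ ω+2
  ω+1<ω+2 : ω+1 <ₒ ω+2

oddℕ : ℕ → Bool
oddℕ zero    = false
oddℕ (suc n) = not (oddℕ n)

oddᵇ : Ord3 → Bool
oddᵇ (fin n) = oddℕ n
oddᵇ ω       = false
oddᵇ ω+1     = true
oddᵇ ω+2     = false

Odd : Ord3 → Set
Odd α = oddᵇ α ≡ true

data _⟶_ : Ord3 → Ord3 → Set where
  down    : ∀ {α β} → β <ₒ α → α ⟶ β
  loopOdd : ∀ {α} → Odd α → α ⟶ α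
  special : ω+1 ⟶ ω+2

Val : ℕ → Ord3 → Set
Val zero    α = Odd α
Val (suc _) α = ⊥

p : ℕ
p = 0

data Form : Set where
  ⊤'    : Form
  var   : ℕ → Form
  ¬'_   : Form → Form
  _∧'_  : Form → Form → Form
  ◇_    : Form → Form
  ◇∞    : List Form → Form

Pred : Set₂
Pred = Ord3 → Set₁

Dia : Pred → Pred
Dia P w = Σ Ord3 λ s → (w ⟶ s) × P s

Star : Pred → Pred
Star P w = P w ⊎ Dia P w

_∩_ : (Ord3 → Set) → Pred → Pred
(X ∩ P) w = Lift (Level.suc Level.zero) (X w) × P w

BigAnd : (Pred → Pred) → (Ord3 → Set) → List Pred → Ord3 → Set₁
BigAnd M X []       w = Lift (Level.suc Level.zero) ⊤
BigAnd M X (P ∷ Γ)  w = M (X ∩ P) w × BigAnd M X Γ w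

-- greatest fixed point νx.⋀_{γ∈Γ} M(x ∧ γ): union of all post-fixed points X
Nu : (Pred → Pred) → List Pred → Pred
Nu M Γ w = Σ (Ord3 → Set) λ X → X w × (∀ v → X v → BigAnd M X Γ v)

DiaInf : List Pred → Pred
DiaInf = Nu Dia

StarInf : List Pred → Pred
StarInf = Nu Star

mutual
  ⟦_⟧ : Form → Pred
  ⟦ ⊤' ⟧     w = Lift (Level.suc Level.zero) ⊤
  ⟦ var n ⟧  w = Lift (Level.suc Level.zero) (Val n w)
  ⟦ ¬' φ ⟧   w = ¬ ⟦ φ ⟧ w
  ⟦ φ ∧' ψ ⟧ w = ⟦ φ ⟧ w × ⟦ ψ ⟧ w
  ⟦ ◇ φ ⟧    w = Dia ⟦ φ ⟧ w
  ⟦ ◇∞ Γ ⟧   w = DiaInf ⟦ Γ ⟧* w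

  ⟦_⟧* : List Form → List Pred
  ⟦ [] ⟧*    = []
  ⟦ φ ∷ Γ ⟧* = ⟦ φ ⟧ ∷ ⟦ Γ ⟧*

target : Pred
target = StarInf (⟦ var p ⟧ ∷ ⟦ ¬' var p ⟧ ∷ [])

DefinedBy : (Form → Set) → Pred → Set₁
DefinedBy Φ P = ∀ w → (P w → ∀ ψ → Φ ψ → ⟦ ψ ⟧ w)
                    × ((∀ ψ → Φ ψ → ⟦ ψ ⟧ w) → P w)

{-# OPTIONS --safe #-}
module Submission where

-- Call a truth set stable if along ℕ it is eventually 2-periodic, agreeing at
-- even numbers with ω and at odd numbers with ω+1, and if it does not separate
-- ω+2 from ω. Every formula of L_{◇∞} has a stable truth set. For ◇ this is
-- because a point above the bound sees all numbers below it, and a stable set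
-- that is inhabited at all is already inhabited below the bound plus two; the
-- only other successor of a point is the point itself when it is odd. For ◇∞Γ
-- it is because an infinite path in S can only end by looping at an odd point
-- (or alternating between ω+1 and ω+2, which needs Γ at ω+1), so at any high
-- point ◇∞Γ holds iff Γ holds simultaneously at some small odd number. But
-- ⟨*⟩∞{p,¬p} separates ω+2 from ω: it holds at ω+2 by the cycle ω+1 → ω+2 → ω+1,
-- and fails at ω since every path from ω falls into ℕ, where p and ¬p cannot
-- alternate forever.

open import Defs
open import Data.Bool using (Bool; true; false; not)
open import Data.List using (List; []; _∷_)
open import Data.Nat using (ℕ; zero; suc; _+_; _≤_; _<_; _⊔_)
open import Data.Nat.Induction using (<-rec)
open import Data.Nat.Properties
  using (≤-refl; ≤-trans; <-≤-trans; <-≤-connex; m≤m⊔n; m≤n⊔m; m≤n+m; n≤1+n; n<1+n; m<n⇒m<1+n)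
open import Data.Product using (Σ; _×_; _,_; proj₁; proj₂)
open import Data.Product.Function.NonDependent.Propositional using (_×-⇔_)
open import Data.Sum using (_⊎_; inj₁; inj₂; [_,_]; map₂)
open import Data.Sum.Function.Propositional using (_⊎-⇔_)
open import Data.Unit using (⊤; tt)
open import Function using (id)
open import Function.Bundles using (_⇔_; mk⇔; Equivalence)
open import Function.Properties.Equivalence using ()
  renaming (refl to ⇔-refl; sym to ⇔-sym; trans to ⇔-trans)
open import Function.Related.TypeIsomorphisms using (¬-cong-⇔)
open import Level using (Lift; lift)
open import Relation.Binary.PropositionalEquality using (_≡_; refl; cong)
open import Relation.Nullary using (¬_)

limit : Bool → Ord3
limit false = ω
limit true  = ω+1

parity-between : ∀ b N → Σ ℕ λ n → N ≤ n × n < 2 + N × oddℕ n ≡ b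
parity-between b N with oddℕ N in eq
parity-between false N | false = N , ≤-refl , m<n⇒m<1+n (n<1+n N) , eq
parity-between true  N | true  = N , ≤-refl , m<n⇒m<1+n (n<1+n N) , eq
parity-between false N | true  = suc N , n≤1+n N , n<1+n (suc N) , cong not eq
parity-between true  N | false = suc N , n≤1+n N , n<1+n (suc N) , cong not eq

High : ℕ → Ord3 → Set
High N (fin n) = N ≤ n
High N _       = ⊤

High-limit : ∀ {N} b → High N (limit b)
High-limit false = tt
High-limit true  = tt

High⟶fin : ∀ {N m} α → High N α → m < N → α ⟶ fin m
High⟶fin (fin n) N≤n m<N = down (fin<fin (<-≤-trans m<N N≤n))
High⟶fin ω       _   _   = down fin<ω
High⟶fin ω+1     _   _   = down fin<ω+1
High⟶fin ω+2     _   _   = down fin<ω+2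

record Stable (Q : Pred) : Set₁ where
  field
    bound     : ℕ
    fin⇔limit : ∀ {n} → bound ≤ n → Q (fin n) ⇔ Q (limit (oddℕ n))
    ω+2⇔ω     : Q ω+2 ⇔ Q ω

open Stable

Low : ℕ → Pred → Set₁
Low N Q = Σ ℕ λ m → m < N × Q (fin m)

module _ {Q : Pred} (S : Stable Q) where

  low-limit : ∀ b → Q (limit b) → Low (2 + bound S) Q
  low-limit b q with parity-between b (bound S)
  ... | n , N≤n , n<2+N , refl = n , n<2+N , Equivalence.from (fin⇔limit S N≤n) q

  low : ∀ α → Q α → Low (2 + bound S) Q
  low (fin m) q with <-≤-connex m (bound S)
  ... | inj₁ m<N = m , <-≤-trans m<N (m≤n+m _ 2) , q
  ... | inj₂ N≤m = low-limit (oddℕ m) (Equivalence.to (fin⇔limit S N≤m) q)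
  low ω   q = low-limit false q
  low ω+1 q = low-limit true q
  low ω+2 q = low-limit false (Equivalence.to (ω+2⇔ω S) q)

Stable-transfer : ∀ {Q R : Pred} M → (∀ α → High M α → Q α ⇔ R α) → Stable R → Stable Q
Stable-transfer {Q} {R} M Q⇔R S = record
  { bound     = M ⊔ bound S
  ; fin⇔limit = λ {n} le → ⇔-trans (Q⇔R (fin n) (≤-trans (m≤m⊔n M _) le))
                           (⇔-trans (fin⇔limit S (≤-trans (m≤n⊔m M _) le))
                                    (⇔-sym (Q⇔R _ (High-limit (oddℕ n)))))
  ; ω+2⇔ω     = ⇔-trans (Q⇔R ω+2 tt) (⇔-trans (ω+2⇔ω S) (⇔-sym (Q⇔R ω tt)))
  }

Stable-const : ∀ W → Stable (λ _ → W)
Stable-const W = record { bound = 0 ; fin⇔limit = λ _ → ⇔-refl ; ω+2⇔ω = ⇔-refl }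

Stable-parity : (F : Bool → Set₁) → Stable (λ α → F (oddᵇ α))
Stable-parity F = record { bound = 0 ; fin⇔limit = λ {n} _ → F-limit (oddℕ n) ; ω+2⇔ω = ⇔-refl }
  where
  F-limit : ∀ b → F b ⇔ F (oddᵇ (limit b))
  F-limit false = ⇔-refl
  F-limit true  = ⇔-refl

Stable-cong₁ : ∀ {Q} {F : Set₁ → Set₁} → (∀ {A B} → A ⇔ B → F A ⇔ F B) →
               Stable Q → Stable (λ α → F (Q α))
Stable-cong₁ F-cong S = record
  { bound = bound S ; fin⇔limit = λ le → F-cong (fin⇔limit S le) ; ω+2⇔ω = F-cong (ω+2⇔ω S) }

Stable-cong₂ : ∀ {Q R} {_∙_ : Set₁ → Set₁ → Set₁} →
               (∀ {A A′ B B′} → A ⇔ A′ → B ⇔ B′ → (A ∙ B) ⇔ (A′ ∙ B′)) →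
               Stable Q → Stable R → Stable (λ α → Q α ∙ R α)
Stable-cong₂ ∙-cong SQ SR = record
  { bound     = bound SQ ⊔ bound SR
  ; fin⇔limit = λ le → ∙-cong (fin⇔limit SQ (≤-trans (m≤m⊔n _ _) le))
                              (fin⇔limit SR (≤-trans (m≤n⊔m _ _) le))
  ; ω+2⇔ω     = ∙-cong (ω+2⇔ω SQ) (ω+2⇔ω SR)
  }

Stable-¬ : ∀ {Q} → Stable Q → Stable (λ α → ¬ Q α)
Stable-¬ = Stable-cong₁ ¬-cong-⇔

Stable-× : ∀ {Q R} → Stable Q → Stable R → Stable (λ α → Q α × R α)
Stable-× = Stable-cong₂ _×-⇔_

Stable-⊎ : ∀ {Q R} → Stable Q → Stable R → Stable (λ α → Q α ⊎ R α)
Stable-⊎ = Stable-cong₂ _⊎-⇔_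

Stable-var : ∀ x → Stable ⟦ var x ⟧
Stable-var zero    = Stable-parity (λ b → Lift _ (b ≡ true))
Stable-var (suc x) = Stable-const _

Stable-Odd∩ : ∀ {Q} → Stable Q → Stable (Odd ∩ Q)
Stable-Odd∩ = Stable-× (Stable-var p)

Dia-High⇔ : ∀ {Q} (S : Stable Q) α → High (2 + bound S) α →
            Dia Q α ⇔ (Low (2 + bound S) Q ⊎ (Odd ∩ Q) α)
Dia-High⇔ {Q} S α high = mk⇔ to from
  where
  to : Dia Q α → Low (2 + bound S) Q ⊎ (Odd ∩ Q) α
  to (_ , loopOdd odd , q) = inj₂ (lift odd , q)
  to (s , _ , q)           = inj₁ (low S s q)

  from : Low (2 + bound S) Q ⊎ (Odd ∩ Q) α → Dia Q α
  from (inj₁ (m , m<N , q))  = fin m , High⟶fin α high m<N , q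
  from (inj₂ (lift odd , q)) = α , loopOdd odd , q

Stable-Dia : ∀ {Q} → Stable Q → Stable (Dia Q)
Stable-Dia S = Stable-transfer _ (Dia-High⇔ S) (Stable-⊎ (Stable-const _) (Stable-Odd∩ S))

Holds : List Pred → Pred
Holds []      α = Lift _ ⊤
Holds (P ∷ Γ) α = P α × Holds Γ α

DiaInf-loop : ∀ Γ {x α} → x ⟶ α → Odd α → Holds Γ α → DiaInf Γ x
DiaInf-loop Γ {x} {α} x⟶α odd holds = X , inj₁ refl , post
  where
  X : Ord3 → Set
  X v = v ≡ x ⊎ v ≡ α

  step-to-α : ∀ {v} Δ → v ⟶ α → Holds Δ α → BigAnd Dia X Δ v
  step-to-α []      _   _       = lift tt
  step-to-α (P ∷ Δ) v⟶α (q , h) = (α , v⟶α , lift (inj₂ refl) , q) , step-to-α Δ v⟶α h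

  post : ∀ v → X v → BigAnd Dia X Γ v
  post _ (inj₁ refl) = step-to-α Γ x⟶α holds
  post _ (inj₂ refl) = step-to-α Γ (loopOdd odd) holds

BigAnd-Dia⇒Holds : ∀ {G : Set₁} {X v t} → (∀ {s} → v ⟶ s → X s → G ⊎ s ≡ t) →
                   ∀ Δ → BigAnd Dia X Δ v → G ⊎ Holds Δ t
BigAnd-Dia⇒Holds escape []      _ = inj₂ (lift tt)
BigAnd-Dia⇒Holds escape (P ∷ Δ) ((_ , v⟶s , lift xs , q) , rest) with escape v⟶s xs
... | inj₁ g    = inj₁ g
... | inj₂ refl = map₂ (q ,_) (BigAnd-Dia⇒Holds escape Δ rest)

module PostFixedPoint (Γ : List Pred) (P : Pred) (X : Ord3 → Set)
                      (post : ∀ v → X v → BigAnd Dia X (P ∷ Γ) v) where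

  OddWitness : Set₁
  OddWitness = Σ Ord3 (Odd ∩ Holds (P ∷ Γ))

  settle : ∀ {v t} → Odd t → (∀ {s} → v ⟶ s → X s → OddWitness ⊎ s ≡ t) → X v → OddWitness
  settle {v} {t} odd escape xv =
    [ id , (λ holds → t , lift odd , holds) ] (BigAnd-Dia⇒Holds escape (P ∷ Γ) (post v xv))

  fin-step : ∀ n → (∀ {m} → m < n → X (fin m) → OddWitness) → X (fin n) → OddWitness
  fin-step n rec xn with proj₁ (post (fin n) xn)
  ... | _ , down (fin<fin m<n) , lift xm , _ = rec m<n xm
  ... | _ , loopOdd odd , _                  = settle odd escape xn
    where
    escape : ∀ {s} → fin n ⟶ s → X s → OddWitness ⊎ s ≡ fin n
    escape (down (fin<fin m<n)) xm = inj₁ (rec m<n xm)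
    escape (loopOdd _)          _  = inj₂ refl

  from-fin : ∀ n → X (fin n) → OddWitness
  from-fin = <-rec (λ n → X (fin n) → OddWitness) fin-step

  from-ω : X ω → OddWitness
  from-ω xω with proj₁ (post ω xω)
  ... | _ , down (fin<ω {m}) , lift xm , _ = from-fin m xm
  ... | _ , loopOdd () , _

  from-ω+2 : X ω+2 → OddWitness
  from-ω+2 = settle refl escape
    where
    escape : ∀ {s} → ω+2 ⟶ s → X s → OddWitness ⊎ s ≡ ω+1
    escape (down (fin<ω+2 {m})) xs = inj₁ (from-fin m xs)
    escape (down ω<ω+2)         xs = inj₁ (from-ω xs)
    escape (down ω+1<ω+2)       _  = inj₂ refl
    escape (loopOdd ())         _

  from-ω+1 : X ω+1 → OddWitness
  from-ω+1 = settle refl escape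
    where
    escape : ∀ {s} → ω+1 ⟶ s → X s → OddWitness ⊎ s ≡ ω+1
    escape (down (fin<ω+1 {m})) xs = inj₁ (from-fin m xs)
    escape (down ω<ω+1)         xs = inj₁ (from-ω xs)
    escape (loopOdd _)          _  = inj₂ refl
    escape special              xs = inj₁ (from-ω+2 xs)

  odd-witness : ∀ v → X v → OddWitness
  odd-witness (fin n) = from-fin n
  odd-witness ω       = from-ω
  odd-witness ω+1     = from-ω+1
  odd-witness ω+2     = from-ω+2

DiaInf⇒odd-witness : ∀ {P Γ x} → DiaInf (P ∷ Γ) x → Σ Ord3 (Odd ∩ Holds (P ∷ Γ))
DiaInf⇒odd-witness {P} {Γ} {x} (X , xx , post) = PostFixedPoint.odd-witness Γ P X post x xx

DiaInf-High⇔ : ∀ {P Γ} (S : Stable (Odd ∩ Holds (P ∷ Γ))) α → High (2 + bound S) α →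
               DiaInf (P ∷ Γ) α ⇔ Low (2 + bound S) (Odd ∩ Holds (P ∷ Γ))
DiaInf-High⇔ {P} {Γ} S α high = mk⇔ to from
  where
  to : DiaInf (P ∷ Γ) α → Low (2 + bound S) (Odd ∩ Holds (P ∷ Γ))
  to d with DiaInf⇒odd-witness d
  ... | β , witness = low S β witness

  from : Low (2 + bound S) (Odd ∩ Holds (P ∷ Γ)) → DiaInf (P ∷ Γ) α
  from (m , m<N , lift odd , holds) = DiaInf-loop (P ∷ Γ) (High⟶fin α high m<N) odd holds

Stable-DiaInf : ∀ {Γ} → Stable (Holds Γ) → Stable (DiaInf Γ)
Stable-DiaInf {[]} _ = Stable-transfer 0 (λ _ _ → mk⇔ _ (λ _ → trivial)) (Stable-const (Lift _ ⊤))
  where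
  trivial : ∀ {α} → DiaInf [] α
  trivial = (λ _ → ⊤) , tt , λ _ _ → lift tt
Stable-DiaInf {P ∷ Γ} S = Stable-transfer _ (DiaInf-High⇔ (Stable-Odd∩ S)) (Stable-const _)

mutual
  Stable-⟦⟧ : ∀ φ → Stable ⟦ φ ⟧
  Stable-⟦⟧ ⊤'       = Stable-const _
  Stable-⟦⟧ (var x)  = Stable-var x
  Stable-⟦⟧ (¬' φ)   = Stable-¬ (Stable-⟦⟧ φ)
  Stable-⟦⟧ (φ ∧' ψ) = Stable-× (Stable-⟦⟧ φ) (Stable-⟦⟧ ψ)
  Stable-⟦⟧ (◇ φ)    = Stable-Dia (Stable-⟦⟧ φ)
  Stable-⟦⟧ (◇∞ Γ)   = Stable-DiaInf (Stable-Holds Γ)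

  Stable-Holds : ∀ Γ → Stable (Holds ⟦ Γ ⟧*)
  Stable-Holds []      = Stable-const _
  Stable-Holds (φ ∷ Γ) = Stable-× (Stable-⟦⟧ φ) (Stable-Holds Γ)

⟦⟧-ω+2⇒ω : ∀ ψ → ⟦ ψ ⟧ ω+2 → ⟦ ψ ⟧ ω
⟦⟧-ω+2⇒ω ψ = Equivalence.to (ω+2⇔ω (Stable-⟦⟧ ψ))

p¬p : List Pred
p¬p = ⟦ var p ⟧ ∷ ⟦ ¬' var p ⟧ ∷ []

target-ω+2 : target ω+2
target-ω+2 = X , inj₂ refl , post
  where
  X : Ord3 → Set
  X v = v ≡ ω+1 ⊎ v ≡ ω+2

  post : ∀ v → X v → BigAnd Star X p¬p v
  post _ (inj₁ refl) = inj₁ (lift (inj₁ refl) , lift refl)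
                     , inj₂ (ω+2 , special , lift (inj₂ refl) , λ { (lift ()) })
                     , lift tt
  post _ (inj₂ refl) = inj₂ (ω+1 , down ω+1<ω+2 , lift (inj₁ refl) , lift refl)
                     , inj₁ (lift (inj₂ refl) , λ { (lift ()) })
                     , lift tt

Star-fin : ∀ {X Q n} → Star (X ∩ Q) (fin n) → (Σ ℕ λ m → m < n × X (fin m)) ⊎ Q (fin n)
Star-fin (inj₁ (_ , q))                                   = inj₂ q
Star-fin (inj₂ (_ , down (fin<fin m<n) , lift xm , _))    = inj₁ (_ , m<n , xm)
Star-fin (inj₂ (_ , loopOdd _ , _ , q))                   = inj₂ q

no-fin : (X : Ord3 → Set) → (∀ v → X v → BigAnd Star X p¬p v) → ∀ n → ¬ X (fin n)
no-fin X post = <-rec (λ n → ¬ X (fin n)) step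
  where
  step : ∀ n → (∀ {m} → m < n → ¬ X (fin m)) → ¬ X (fin n)
  step n rec xn with post (fin n) xn
  ... | starP , star¬P , _ with Star-fin starP | Star-fin star¬P
  ... | inj₁ (_ , m<n , xm) | _                   = rec m<n xm
  ... | inj₂ _              | inj₁ (_ , m<n , xm) = rec m<n xm
  ... | inj₂ odd            | inj₂ ¬odd           = ¬odd odd

¬target-ω : ¬ target ω
¬target-ω (X , xω , post) with proj₁ (post ω xω)
... | inj₁ (_ , lift ())
... | inj₂ (_ , down (fin<ω {m}) , lift xm , _) = no-fin X post m xm
... | inj₂ (_ , loopOdd () , _)

mainTheorem5 : ¬ (Σ (Form → Set) λ Φ → DefinedBy Φ target)
mainTheorem5 (Φ , defines) = ¬target-ω (proj₂ (defines ω) ψ-at-ω)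
  where
  ψ-at-ω : ∀ ψ → Φ ψ → ⟦ ψ ⟧ ω
  ψ-at-ω ψ ψ∈Φ = ⟦⟧-ω+2⇒ω ψ (proj₁ (defines ω+2) target-ω+2 ψ ψ∈Φ)
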